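{- Let $k \geq 2$ be an integer and let $T$ be a rooted tree in which the eccentricity of the root is at most $k$. Then $\gamma_{all,k}^\infty(T) \leq 2$.
   Context: The eccentricity of a vertex $u$ is $\max_v d(u,v)$. Graphs are finite and simple; $d(u,v)$ is graph distance and $N_k[x]=\{v: d(x,v)\le k\}$. A multiset $D$ of vertices of $G$ is a distance-$k$ dominating set if every vertex of $V(G)\setminus D$ is at distance at most $k$ from some element of $D$. Let $\mathbb{D}_{k,q}(G)$ be the set of such multisets of cardinality $q$. $D=\{v_1,\dots,v_q\}$ transforms to $D'=\{u_1,\dots,u_q\}$ if (for some indexing) $u_i\in N_k[v_i]$ for all $i$. An eternal distance-$k$ dominating family is $\mathcal{E}\subseteq\mathbb{D}_{k,q}(G)$ for some $q$ such that for every $D\in\mathcal{E}$ and every vertex $v$ there is $D'\in\mathcal{E}$ with $v\in D'$ and $D$ transforms to $D'$. $\gamma_{all,k}^\infty(G)$ is the minimum $q$ for which such a family exists. -}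

module Defs where

open import Data.Nat using (ℕ; zero; suc; _≤_)
open import Data.Fin using (Fin)
open import Data.Vec using (Vec; lookup)
open import Data.Vec.Membership.Propositional using (_∈_)
open import Data.List using (List; []; _∷_; length)
open import Data.List.Relation.Unary.Unique.Propositional using (Unique)
open import Data.Product using (Σ; ∃; ∃-syntax; _×_; _,_)
open import Data.Sum using (_⊎_)
open import Data.Empty using (⊥)
open import Data.Unit using (⊤)
open import Relation.Nullary using (¬_)
open import Relation.Binary.PropositionalEquality using (_≡_)
open import Function.Bundles using (_↔_; Inverse)

record Graph (n : ℕ) : Set₁ where
  field
    Adj     : Fin n → Fin n → Set
    sym     : ∀ {u v} → Adj u v → Adj v u
    irrefl  : ∀ {u} → ¬ Adj u u

module _ {n : ℕ} (G : Graph n) where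
  open Graph G

  data Walk : Fin n → Fin n → ℕ → Set where
    here  : ∀ {u} → Walk u u zero
    step  : ∀ {u w v m} → Adj u w → Walk w v m → Walk u v (suc m)

  Dist≤ : Fin n → Fin n → ℕ → Set
  Dist≤ u v k = ∃[ m ] (m ≤ k × Walk u v m)

  Connected : Set
  Connected = ∀ u v → ∃[ m ] Walk u v m

  Chain : Fin n → List (Fin n) → Set
  Chain x []       = ⊤
  Chain x (y ∷ ys) = Adj x y × Chain y ys

  Last : Fin n → List (Fin n) → Fin n
  Last x []       = x
  Last x (y ∷ ys) = Last y ys

  -- A cycle: distinct vertices x, y₁, …, yₘ (m ≥ 2, so at least 3 vertices),
  -- consecutive ones adjacent, and yₘ adjacent to x.
  IsCycle : Fin n → List (Fin n) → Set
  IsCycle x ys = 2 ≤ length ys × Unique (x ∷ ys) × Chain x ys × Adj (Last x ys) x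

  Acyclic : Set
  Acyclic = ∀ x ys → ¬ IsCycle x ys

  IsTree : Set
  IsTree = Connected × Acyclic

  eccentricity≤ : Fin n → ℕ → Set
  eccentricity≤ u k = ∀ v → Dist≤ u v k

  -- Multisets of q vertices, represented as vectors (order is irrelevant below,
  -- since transformation allows arbitrary re-indexing).
  DistDom : ℕ → {q : ℕ} → Vec (Fin n) q → Set
  DistDom k D = ∀ v → ¬ (v ∈ D) → ∃[ i ] Dist≤ (lookup D i) v k

  Transforms : ℕ → {q : ℕ} → Vec (Fin n) q → Vec (Fin n) q → Set
  Transforms k {q} D D′ =
    Σ (Fin q ↔ Fin q) λ σ → ∀ i → Dist≤ (lookup D i) (lookup D′ (Inverse.to σ i)) k

  record EternalFamily (k q : ℕ) : Set₁ where
    field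
      Mem      : Vec (Fin n) q → Set
      nonempty : ∃[ D ] Mem D
      dom      : ∀ D → Mem D → DistDom k D
      eternal  : ∀ D → Mem D → ∀ v →
                 ∃[ D′ ] (Mem D′ × v ∈ D′ × Transforms k D D′)

  γ∞all≤ : ℕ → ℕ → Set₁
  γ∞all≤ k q = ∃[ p ] (p ≤ q × EternalFamily k p)

{-# OPTIONS --safe #-}
-- Keep one guard on the root r. When a vertex v is attacked, the guard on r
-- moves to v and the other guard moves to r; both moves have length at most k
-- because every vertex is within distance k of r. Hence the pairs containing r
-- form an eternal family, for any graph with a vertex of eccentricity at most k.
module Submission where

open import Defs
open import Data.Nat using (ℕ; _≤_; suc; s≤s; z≤n)
open import Data.Fin using (Fin; zero; suc)
open import Data.Vec using (Vec; []; _∷_; lookup)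
open import Data.Vec.Membership.Propositional using (_∈_)
open import Data.Vec.Relation.Unary.Any using (here; there)
open import Data.Product using (∃-syntax; _×_; _,_)
open import Data.Sum using (_⊎_; inj₁; inj₂)
open import Relation.Binary.PropositionalEquality using (_≡_; refl)
open import Function.Construct.Identity using (↔-id)

module _ {n : ℕ} (G : Graph n) where
  open Graph G

  Walk-snoc : ∀ {u v w m} → Walk G u v m → Adj v w → Walk G u w (suc m)
  Walk-snoc here         a = step a here
  Walk-snoc (step b p) a = step b (Walk-snoc p a)

  Walk-reverse : ∀ {u v m} → Walk G u v m → Walk G v u m
  Walk-reverse here       = here
  Walk-reverse (step a p) = Walk-snoc (Walk-reverse p) (sym a)

  Dist≤-sym : ∀ {u v k} → Dist≤ G u v k → Dist≤ G v u k
  Dist≤-sym (m , m≤k , p) = m , m≤k , Walk-reverse p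

  module _ {k : ℕ} {r : Fin n} (ecc : eccentricity≤ G r k) where

    OccupiesCentre : Vec (Fin n) 2 → Set
    OccupiesCentre D = lookup D zero ≡ r ⊎ lookup D (suc zero) ≡ r

    from-centre : ∀ {x} → x ≡ r → ∀ v → Dist≤ G x v k
    from-centre refl = ecc

    to-centre : ∀ x → Dist≤ G x r k
    to-centre x = Dist≤-sym (ecc x)

    OccupiesCentre-dominates : ∀ D → OccupiesCentre D → DistDom G k D
    OccupiesCentre-dominates (_ ∷ _ ∷ []) (inj₁ a≡r) v _ = zero , from-centre a≡r v
    OccupiesCentre-dominates (_ ∷ _ ∷ []) (inj₂ b≡r) v _ = suc zero , from-centre b≡r v

    OccupiesCentre-eternal : ∀ D → OccupiesCentre D → ∀ v →
      ∃[ D′ ] (OccupiesCentre D′ × v ∈ D′ × Transforms G k D D′)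
    OccupiesCentre-eternal (a ∷ b ∷ []) (inj₁ a≡r) v =
      v ∷ r ∷ [] , inj₂ refl , here refl , ↔-id (Fin 2) , moves
      where
      moves : ∀ i → Dist≤ G (lookup (a ∷ b ∷ []) i) (lookup (v ∷ r ∷ []) i) k
      moves zero       = from-centre a≡r v
      moves (suc zero) = to-centre b
    OccupiesCentre-eternal (a ∷ b ∷ []) (inj₂ b≡r) v =
      r ∷ v ∷ [] , inj₁ refl , there (here refl) , ↔-id (Fin 2) , moves
      where
      moves : ∀ i → Dist≤ G (lookup (a ∷ b ∷ []) i) (lookup (r ∷ v ∷ []) i) k
      moves zero       = to-centre a
      moves (suc zero) = from-centre b≡r v

    OccupiesCentre-eternalFamily : EternalFamily G k 2
    OccupiesCentre-eternalFamily = record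
      { Mem      = OccupiesCentre
      ; nonempty = r ∷ r ∷ [] , inj₁ refl
      ; dom      = OccupiesCentre-dominates
      ; eternal  = OccupiesCentre-eternal
      }

  γ∞all≤2-of-eccentricity≤ : ∀ {k} r → eccentricity≤ G r k → γ∞all≤ G k 2
  γ∞all≤2-of-eccentricity≤ r ecc = 2 , s≤s (s≤s z≤n) , OccupiesCentre-eternalFamily ecc

proposition2 : (k : ℕ) → 2 ≤ k → (n : ℕ) → (T : Graph n) → IsTree T →
    (r : Fin n) → eccentricity≤ T r k → γ∞all≤ T k 2
proposition2 k _ n T _ r ecc = γ∞all≤2-of-eccentricity≤ T r ecc
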